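{- Let $m,n$ be integers with $1\le m<n$ and $n\le 2m+1$. Then $\dim(VG^2_{m,n})=3$.
   Context: For a connected graph $G$ and an ordered set $R=\{r_1,\dots,r_l\}\subseteq V(G)$, the code of a vertex $s$ is $(d(s,r_1),\dots,d(s,r_l))$, where $d$ is the shortest-path distance. $R$ is a resolving set if distinct vertices have distinct codes; $\dim(G)$ (the metric dimension) is the minimum cardinality of a resolving set. For integers $1\le m<n$, the Villarceau grid Type II $VG^2_{m,n}$ is the graph with vertex set $\{(2i+1,2j+1): i\in\{0,\dots,n-2\},\ j\in\{0,\dots,m-1\}\}\cup\{(2i,2j): i\in\{0,\dots,n-1\},\ j\in\{0,\dots,m\}\}$, in which $(i_1,j_1)$ and $(i_2,j_2)$ are adjacent if and only if $|i_1-i_2|=1$ and $|j_1-j_2|=1$. -}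

module Defs where

open import Data.Nat using (ℕ; zero; suc; _+_; _*_; _≤_; _<_)
open import Data.Product using (_×_; _,_; Σ; ∃; ∃-syntax)
open import Data.Sum using (_⊎_)
open import Data.List using (List; length)
open import Data.List.Relation.Unary.All using (All)
open import Data.List.Relation.Unary.Unique.Propositional using (Unique)
open import Relation.Binary.PropositionalEquality using (_≡_)

Point : Set
Point = ℕ × ℕ

data IsVertex (m n : ℕ) : Point → Set where
  odd  : ∀ i j → suc i < n → j < m → IsVertex m n (suc (2 * i) , suc (2 * j))
  even : ∀ i j → i < n → j ≤ m → IsVertex m n (2 * i , 2 * j)

Diff1 : ℕ → ℕ → Set
Diff1 a b = (a ≡ suc b) ⊎ (b ≡ suc a)

Adj : (m n : ℕ) → Point → Point → Set
Adj m n (x₁ , y₁) (x₂ , y₂) =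
  IsVertex m n (x₁ , y₁) × IsVertex m n (x₂ , y₂) × Diff1 x₁ x₂ × Diff1 y₁ y₂

data Walk (m n : ℕ) : Point → Point → ℕ → Set where
  here : ∀ {u} → IsVertex m n u → Walk m n u u zero
  step : ∀ {u w v k} → Adj m n u w → Walk m n w v k → Walk m n u v (suc k)

Dist : (m n : ℕ) → Point → Point → ℕ → Set
Dist m n u v k = Walk m n u v k × (∀ k′ → Walk m n u v k′ → k ≤ k′)

SameCode : (m n : ℕ) → List Point → Point → Point → Set
SameCode m n R s t = All (λ r → ∃[ k ] (Dist m n s r k × Dist m n t r k)) R

Resolving : (m n : ℕ) → List Point → Set
Resolving m n R =
  Unique R × All (IsVertex m n) R ×
  (∀ s t → IsVertex m n s → IsVertex m n t → SameCode m n R s t → s ≡ t)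

MetricDim : (m n : ℕ) → ℕ → Set
MetricDim m n d =
  (∃[ R ] (Resolving m n R × length R ≡ d)) ×
  (∀ R → Resolving m n R → d ≤ length R)

-- VG²_{m,n} is the set of points of the box [0, W] × [0, H], W = 2(n - 1), H = 2m, whose
-- coordinates have equal parity, with diagonal unit steps as edges. Its graph distance is the
-- Chebyshev distance d∞: step diagonally towards the target; equal parity of the two gaps lets
-- both close together. The corners (0,0), (W,0), (H,H) resolve the graph because, when W ≤ 2H,
-- a point is recovered from its three d∞'s by a short case analysis. Conversely, every vertex a
-- has a vertex with three distinct neighbours equidistant from a (a itself if odd, an adjacent
-- odd vertex otherwise). The graph is bipartite, so their distances to any b are d(centre, b) ± 1
-- and two of them coincide: no two landmarks resolve.

module Submission where

open import Defs
open import Data.Nat using (ℕ; zero; suc; _≤_; _<_; _+_; _*_; _∸_; _⊔_; ∣_-_∣; parity; z≤n; s≤s)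
open import Data.Nat.Properties
open import Data.Parity.Base as ℙ using (0ℙ; 1ℙ; _⁻¹)
import Data.Parity.Properties as ℙ
open import Data.Product using (_×_; _,_; ∃-syntax; proj₁; proj₂)
open import Data.Sum using (_⊎_; inj₁; inj₂)
open import Function using (_∘′_)
open import Data.List using (List; []; _∷_; length)
open import Data.List.Relation.Unary.All as All using (All; []; _∷_)
open import Data.List.Relation.Unary.AllPairs using ([]; _∷_)
open import Data.List.Relation.Unary.Unique.Propositional using (Unique)
open import Relation.Nullary using (¬_; yes; no; contradiction)
open import Relation.Binary using (Tri; tri<; tri≈; tri>)
open import Relation.Binary.PropositionalEquality

private
  variable
    a b c d k l m n' x y z L : ℕ
    s t u v w : Point
    R : List Point

parity-suc : ∀ n → parity (suc n) ≡ parity n ⁻¹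
parity-suc n = ℙ.+-homo-+ 1 n

parity-2* : ∀ i → parity (2 * i) ≡ 0ℙ
parity-2* i = ℙ.*-homo-* 2 i

parity-1+2* : ∀ i → parity (suc (2 * i)) ≡ 1ℙ
parity-1+2* i = trans (parity-suc (2 * i)) (cong _⁻¹ (parity-2* i))

p⁻¹+q⁻¹≡p+q : ∀ p q → p ⁻¹ ℙ.+ q ⁻¹ ≡ p ℙ.+ q
p⁻¹+q⁻¹≡p+q 0ℙ q = ℙ.⁻¹-involutive q
p⁻¹+q⁻¹≡p+q 1ℙ q = refl

parity-∣-∣ : ∀ a b → parity ∣ a - b ∣ ≡ parity a ℙ.+ parity b
parity-∣-∣ zero    b       = refl
parity-∣-∣ (suc a) zero    = sym (ℙ.+-identityʳ (parity (suc a)))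
parity-∣-∣ (suc a) (suc b) = begin
  parity ∣ a - b ∣                      ≡⟨ parity-∣-∣ a b ⟩
  parity a ℙ.+ parity b                 ≡⟨ p⁻¹+q⁻¹≡p+q (parity a) (parity b) ⟨
  parity a ⁻¹ ℙ.+ parity b ⁻¹           ≡⟨ cong₂ ℙ._+_ (parity-suc a) (parity-suc b) ⟨
  parity (suc a) ℙ.+ parity (suc b)     ∎
  where open ≡-Reasoning

parity-2*≢parity-1+2* : ∀ i j → parity (2 * i) ≢ parity (suc (2 * j))
parity-2*≢parity-1+2* i j e with trans (sym (parity-2* i)) (trans e (parity-1+2* j))
... | ()

2*-suc : ∀ i → 2 * suc i ≡ suc (suc (2 * i))
2*-suc i = cong suc (+-suc i (i + 0))

2*-≢ : a ≢ b → 2 * a ≢ 2 * b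
2*-≢ {a} {b} a≢b = a≢b ∘′ *-cancelˡ-≡ a b 2

Diff1-sym : Diff1 a b → Diff1 b a
Diff1-sym (inj₁ e) = inj₂ e
Diff1-sym (inj₂ e) = inj₁ e

Diff1⇒parity⁻¹ : Diff1 a b → parity a ≡ parity b ⁻¹
Diff1⇒parity⁻¹ {b = b} (inj₁ refl) = parity-suc b
Diff1⇒parity⁻¹ {a = a} (inj₂ refl) =
  sym (trans (cong _⁻¹ (parity-suc a)) (ℙ.⁻¹-involutive (parity a)))

Diff1⇒parity-+ : ∀ q → Diff1 a b → parity a ℙ.+ q ≡ (parity b ℙ.+ q) ⁻¹
Diff1⇒parity-+ {b = b} q d = trans (cong (ℙ._+ q) (Diff1⇒parity⁻¹ d)) (ℙ.+-assoc 1ℙ (parity b) q)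

∣n-1+n∣≡1 : ∀ n → ∣ n - suc n ∣ ≡ 1
∣n-1+n∣≡1 zero    = refl
∣n-1+n∣≡1 (suc n) = ∣n-1+n∣≡1 n

Diff1⇒∣-∣≡1 : Diff1 a b → ∣ a - b ∣ ≡ 1
Diff1⇒∣-∣≡1 {b = b} (inj₁ refl) = trans (∣-∣-comm (suc b) b) (∣n-1+n∣≡1 b)
Diff1⇒∣-∣≡1 {a = a} (inj₂ refl) = ∣n-1+n∣≡1 a

≤suc-≢⇒Diff1 : k ≤ suc l → l ≤ suc k → k ≢ l → Diff1 k l
≤suc-≢⇒Diff1 {k} {l} k≤1+l l≤1+k k≢l with <-cmp k l
... | tri< k<l _ _ = inj₂ (≤-antisym l≤1+k k<l)
... | tri≈ _ k≡l _ = contradiction k≡l k≢l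
... | tri> _ _ l<k = inj₁ (≤-antisym k≤1+l l<k)

Diff1-pigeonhole : Diff1 a d → Diff1 b d → Diff1 c d → a ≡ b ⊎ a ≡ c ⊎ b ≡ c
Diff1-pigeonhole (inj₁ refl) (inj₁ refl) _           = inj₁ refl
Diff1-pigeonhole (inj₂ e₁)   (inj₂ e₂)   _           = inj₁ (suc-injective (trans (sym e₁) e₂))
Diff1-pigeonhole (inj₁ refl) (inj₂ _)    (inj₁ refl) = inj₂ (inj₁ refl)
Diff1-pigeonhole (inj₁ _)    (inj₂ e₂)   (inj₂ e₃)   = inj₂ (inj₂ (suc-injective (trans (sym e₂) e₃)))
Diff1-pigeonhole (inj₂ e₁)   (inj₁ _)    (inj₂ e₃)   = inj₂ (inj₁ (suc-injective (trans (sym e₁) e₃)))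
Diff1-pigeonhole (inj₂ _)    (inj₁ refl) (inj₁ refl) = inj₂ (inj₂ refl)

adj-sym : ∀ {m n} → Adj m n u v → Adj m n v u
adj-sym (u∈ , v∈ , dx , dy) = v∈ , u∈ , Diff1-sym dx , Diff1-sym dy

walk-parity : ∀ {m n} → Walk m n u v k → parity k ≡ parity (proj₁ u) ℙ.+ parity (proj₁ v)
walk-parity {u = x , _} (here _) = sym (ℙ.p+p≡0ℙ (parity x))
walk-parity {u = xu , _} {v = xv , _} {k = suc k} (step {w = xw , _} (_ , _ , dx , _) walk) = begin
  parity (suc k)                 ≡⟨ parity-suc k ⟩
  parity k ⁻¹                    ≡⟨ cong _⁻¹ (walk-parity walk) ⟩
  (parity xw ℙ.+ parity xv) ⁻¹   ≡⟨ Diff1⇒parity-+ (parity xv) dx ⟨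
  parity xu ℙ.+ parity xv        ∎
  where open ≡-Reasoning

dist-adjacent : ∀ {m n} → Adj m n s v → Dist m n s w k → Dist m n v w l → Diff1 k l
dist-adjacent {s = xs , _} {v = xv , _} {w = xw , _} {k = k} {l = l}
              s~v@(_ , _ , dx , _) (walk-s , minimal-s) (walk-v , minimal-v) =
  ≤suc-≢⇒Diff1 (minimal-s _ (step s~v walk-v)) (minimal-v _ (step (adj-sym s~v) walk-s)) k≢l
  where
    parity-k : parity k ≡ parity l ⁻¹
    parity-k = begin
      parity k                    ≡⟨ walk-parity walk-s ⟩
      parity xs ℙ.+ parity xw     ≡⟨ Diff1⇒parity-+ (parity xw) dx ⟩
      (parity xv ℙ.+ parity xw) ⁻¹ ≡⟨ cong _⁻¹ (walk-parity walk-v) ⟨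
      parity l ⁻¹                 ∎
      where open ≡-Reasoning
    k≢l : k ≢ l
    k≢l k≡l = ℙ.p≢p⁻¹ (parity l) (trans (cong parity (sym k≡l)) parity-k)

d∞ : Point → Point → ℕ
d∞ (x₁ , y₁) (x₂ , y₂) = ∣ x₁ - x₂ ∣ ⊔ ∣ y₁ - y₂ ∣

d∞≡0⇒≡ : d∞ u v ≡ 0 → u ≡ v
d∞≡0⇒≡ {x₁ , y₁} {x₂ , y₂} e = cong₂ _,_
  (∣m-n∣≡0⇒m≡n (n≤0⇒n≡0 (≤-trans (m≤m⊔n _ _) (≤-reflexive e))))
  (∣m-n∣≡0⇒m≡n (n≤0⇒n≡0 (≤-trans (m≤n⊔m _ _) (≤-reflexive e))))

adj⇒d∞≡1 : ∀ {m n} → Adj m n u v → d∞ u v ≡ 1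
adj⇒d∞≡1 (_ , _ , dx , dy) = cong₂ _⊔_ (Diff1⇒∣-∣≡1 dx) (Diff1⇒∣-∣≡1 dy)

Diff1-∣-∣-≤ : Diff1 a b → ∣ b - c ∣ ≤ k → ∣ a - c ∣ ≤ suc k
Diff1-∣-∣-≤ {a} {b} {c} d ∣b-c∣≤k = ≤-trans (∣-∣-triangle a b c)
  (subst (λ e → e + ∣ b - c ∣ ≤ suc _) (sym (Diff1⇒∣-∣≡1 d)) (s≤s ∣b-c∣≤k))

walk⇒d∞≤ : ∀ {m n} → Walk m n u v k → d∞ u v ≤ k
walk⇒d∞≤ {u = x , y} (here _) = ≤-reflexive (cong₂ _⊔_ (∣n-n∣≡0 x) (∣n-n∣≡0 y))
walk⇒d∞≤ (step (_ , _ , dx , dy) walk) = ⊔-lub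
  (Diff1-∣-∣-≤ dx (≤-trans (m≤m⊔n _ _) (walk⇒d∞≤ walk)))
  (Diff1-∣-∣-≤ dy (≤-trans (m≤n⊔m _ _) (walk⇒d∞≤ walk)))

Box : ℕ → ℕ → Point → Set
Box W H (x , y) = x ≤ W × y ≤ H × parity x ≡ parity y

data Halving : ℕ → Set where
  twice   : ∀ i → Halving (2 * i)
  twice+1 : ∀ i → Halving (suc (2 * i))

halving : ∀ x → Halving x
halving zero = twice 0
halving (suc x) with halving x
... | twice i   = twice+1 i
... | twice+1 i = subst Halving (2*-suc i) (twice (suc i))

isVertex⇒box : IsVertex m (suc n') u → Box (2 * n') (2 * m) u
isVertex⇒box (odd i j (s≤s i<n') j<m) =
  *-monoʳ-< 2 i<n' , *-monoʳ-< 2 j<m , trans (parity-1+2* i) (sym (parity-1+2* j))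
isVertex⇒box (even i j (s≤s i≤n') j≤m) =
  *-monoʳ-≤ 2 i≤n' , *-monoʳ-≤ 2 j≤m , trans (parity-2* i) (sym (parity-2* j))

box⇒isVertex : Box (2 * n') (2 * m) u → IsVertex m (suc n') u
box⇒isVertex {n'} {m} {x , y} (x≤W , y≤H , px≡py) with halving x | halving y
... | twice i   | twice j   = even i j (s≤s (*-cancelˡ-≤ 2 x≤W)) (*-cancelˡ-≤ 2 y≤H)
... | twice+1 i | twice+1 j = odd i j (s≤s (*-cancelˡ-< 2 i n' x≤W)) (*-cancelˡ-< 2 j m y≤H)
... | twice i   | twice+1 j = contradiction px≡py (parity-2*≢parity-1+2* i j)
... | twice+1 i | twice j   = contradiction (sym px≡py) (parity-2*≢parity-1+2* j i)

-- When already at the target a unit step must overshoot it, hence approach 0 = 1.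
approach : ℕ → ℕ
approach zero    = 1
approach (suc d) = d

approach-from-below : x < z → ∣ suc x - z ∣ ≡ approach ∣ x - z ∣
approach-from-below {zero}  {suc z} _         = refl
approach-from-below {suc x} {suc z} (s≤s x<z) = approach-from-below x<z

approach-from-above : z ≤ x → ∣ x - z ∣ ≡ approach ∣ suc x - z ∣
approach-from-above {zero}  {x}     _         = ∣-∣-identityʳ x
approach-from-above {suc z} {suc x} (s≤s z≤x) = approach-from-above z≤x

approach-at-target : Diff1 x y → ∣ y - x ∣ ≡ approach ∣ x - x ∣
approach-at-target {x} d = trans (Diff1⇒∣-∣≡1 (Diff1-sym d)) (cong approach (sym (∣n-n∣≡0 x)))

step-towards : 1 ≤ L → x ≤ L → z ≤ L →
               ∃[ x′ ] Diff1 x x′ × x′ ≤ L × ∣ x′ - z ∣ ≡ approach ∣ x - z ∣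
step-towards {L} {x} {z} 1≤L x≤L z≤L with <-cmp x z
... | tri< x<z _ _ = suc x , inj₂ refl , ≤-trans x<z z≤L , approach-from-below x<z
step-towards {x = suc x} _ x≤L _ | tri> _ _ z<x =
  x , inj₁ refl , ≤-trans (n≤1+n x) x≤L , approach-from-above (≤-pred z<x)
step-towards {L} {x} _ _ _ | tri≈ _ refl _ with x <? L
... | yes x<L = suc x , inj₂ refl , x<L , approach-at-target {x} (inj₂ refl)
step-towards {x = suc x} _ x≤L _ | tri≈ _ refl _ | no _ =
  x , inj₁ refl , ≤-trans (n≤1+n x) x≤L , approach-at-target {suc x} (inj₁ refl)
step-towards {x = zero} 1≤L _ _ | tri≈ _ refl _ | no 0≮L = contradiction 1≤L 0≮L

-- Equal parity excludes the gaps 0 and 1, the only case where overshooting would not be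
-- absorbed by the other coordinate.
approach-⊔ : parity a ≡ parity b → a ⊔ b ≡ suc k → approach a ⊔ approach b ≡ k
approach-⊔ {zero}        {zero}        _  ()
approach-⊔ {zero}        {suc zero}    () _
approach-⊔ {suc zero}    {zero}        () _
approach-⊔ {zero}        {suc (suc b)} _  e = suc-injective e
approach-⊔ {suc (suc a)} {zero}        _  e = trans (cong suc (⊔-identityʳ a)) (suc-injective e)
approach-⊔ {suc a}       {suc b}       _  e = suc-injective e

Twins : (m n : ℕ) → List Point → Set
Twins m n R = ∃[ s ] ∃[ t ] IsVertex m n s × IsVertex m n t × s ≢ t × SameCode m n R s t

twins-tail : ∀ {m n r} → Twins m n (r ∷ R) → Twins m n R
twins-tail (s , t , s∈ , t∈ , s≢t , same) = s , t , s∈ , t∈ , s≢t , All.tail same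

twins⇒¬resolving : ∀ {m n} → Twins m n R → ¬ Resolving m n R
twins⇒¬resolving (s , t , s∈ , t∈ , s≢t , same) (_ , _ , resolves) = s≢t (resolves s t s∈ t∈ same)

∣x-h∣⊔[h∸y]≡h∸y : ∀ h → y ≤ x → x + y ≤ h + h → ∣ x - h ∣ ⊔ (h ∸ y) ≡ h ∸ y
∣x-h∣⊔[h∸y]≡h∸y {y} {x} h y≤x x+y≤2h = m≤n⇒m⊔n≡n ∣x-h∣≤h∸y
  where
    ∣x-h∣≤h∸y : ∣ x - h ∣ ≤ h ∸ y
    ∣x-h∣≤h∸y with x ≤? h
    ... | yes x≤h = ≤-trans (≤-reflexive (m≤n⇒∣m-n∣≡n∸m x≤h)) (∸-monoʳ-≤ h y≤x)
    ... | no  x≰h = ≤-trans (≤-reflexive (m≤n⇒∣n-m∣≡n∸m h≤x)) (m+n≤o⇒m≤o∸n (x ∸ h) x∸h+y≤h)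
      where
        h≤x = <⇒≤ (≰⇒> x≰h)
        x∸h+y≤h : x ∸ h + y ≤ h
        x∸h+y≤h = begin
          x ∸ h + y    ≡⟨ +-∸-comm y h≤x ⟨
          x + y ∸ h    ≤⟨ ∸-monoˡ-≤ h x+y≤2h ⟩
          h + h ∸ h    ≡⟨ m+n∸n≡m h h ⟩
          h            ∎
          where open ≤-Reasoning

∣x-h∣⊔[h∸y]≡h∸x : ∀ h → x ≤ y → y ≤ h → ∣ x - h ∣ ⊔ (h ∸ y) ≡ h ∸ x
∣x-h∣⊔[h∸y]≡h∸x {x} {y} h x≤y y≤h = trans
  (cong (_⊔ (h ∸ y)) (m≤n⇒∣m-n∣≡n∸m (≤-trans x≤y y≤h)))
  (m≥n⇒m⊔n≡m (∸-monoʳ-≤ h x≤y))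

module Decoding (W H : ℕ) where

  private
    variable
      A B C : ℕ

  code : Point → ℕ × ℕ × ℕ
  code p = d∞ p (0 , 0) , d∞ p (W , 0) , d∞ p (H , H)

  -- On the box, code (x , y) = (x ⊔ y , (W ∸ x) ⊔ y , ∣ x - H ∣ ⊔ (H ∸ y)). Either A + B = W and
  -- A = x, or y = A ⊓ B and the other one is x or W ∸ x; on a tie A = B = y, x is read off from C.
  decode : ℕ × ℕ × ℕ → Point
  decode (A , B , C) with A + B ≟ W | <-cmp A B
  ... | yes _ | _          = A , H ∸ C
  ... | no _  | tri< _ _ _ = W ∸ B , A
  ... | no _  | tri≈ _ _ _ = H ∸ C , A
  ... | no _  | tri> _ _ _ = A , B

  decode-+≡ : A + B ≡ W → decode (A , B , C) ≡ (A , H ∸ C)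
  decode-+≡ {A} {B} A+B≡W with A + B ≟ W | <-cmp A B
  ... | yes _   | _ = refl
  ... | no A+B≢W | _ = contradiction A+B≡W A+B≢W

  decode-< : W < A + B → A < B → decode (A , B , C) ≡ (W ∸ B , A)
  decode-< {A} {B} W<A+B A<B with A + B ≟ W | <-cmp A B
  ... | yes A+B≡W | _            = contradiction (sym A+B≡W) (<⇒≢ W<A+B)
  ... | no _      | tri< _ _ _   = refl
  ... | no _      | tri≈ A≮B _ _ = contradiction A<B A≮B
  ... | no _      | tri> A≮B _ _ = contradiction A<B A≮B

  decode-≡ : W < A + A → decode (A , A , C) ≡ (H ∸ C , A)
  decode-≡ {A} W<A+A with A + A ≟ W | <-cmp A A
  ... | yes A+A≡W | _            = contradiction (sym A+A≡W) (<⇒≢ W<A+A)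
  ... | no _      | tri< A<A _ _ = contradiction A<A (<-irrefl refl)
  ... | no _      | tri≈ _ _ _   = refl
  ... | no _      | tri> _ _ A<A = contradiction A<A (<-irrefl refl)

  decode-> : W < A + B → B < A → decode (A , B , C) ≡ (A , B)
  decode-> {A} {B} W<A+B B<A with A + B ≟ W | <-cmp A B
  ... | yes A+B≡W | _            = contradiction (sym A+B≡W) (<⇒≢ W<A+B)
  ... | no _      | tri< _ _ B≮A = contradiction B<A B≮A
  ... | no _      | tri≈ _ _ B≮A = contradiction B<A B≮A
  ... | no _      | tri> _ _ _   = refl

  code-box : x ≤ W → y ≤ H → code (x , y) ≡ (x ⊔ y , (W ∸ x) ⊔ y , ∣ x - H ∣ ⊔ (H ∸ y))
  code-box {x} {y} x≤W y≤H = cong₂ _,_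
    (cong₂ _⊔_ (∣-∣-identityʳ x) (∣-∣-identityʳ y))
    (cong₂ _,_ (cong₂ _⊔_ (m≤n⇒∣m-n∣≡n∸m x≤W) (∣-∣-identityʳ y))
               (cong (∣ x - H ∣ ⊔_) (m≤n⇒∣m-n∣≡n∸m y≤H)))

  module _ {x y} (x≤W : x ≤ W) (y≤H : y ≤ H) where

    private
      Cxy : ℕ
      Cxy = ∣ x - H ∣ ⊔ (H ∸ y)
      x+u≡W : x + (W ∸ x) ≡ W
      x+u≡W = m+[n∸m]≡n x≤W

    decode-bottom : W ≤ H + H → y ≤ x → y ≤ W ∸ x → decode (x ⊔ y , (W ∸ x) ⊔ y , Cxy) ≡ (x , y)
    decode-bottom W≤2H y≤x y≤u = begin
      decode (x ⊔ y , (W ∸ x) ⊔ y , Cxy)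
        ≡⟨ cong₂ (λ A B → decode (A , B , Cxy)) (m≥n⇒m⊔n≡m y≤x) (m≥n⇒m⊔n≡m y≤u) ⟩
      decode (x , W ∸ x , Cxy)  ≡⟨ decode-+≡ x+u≡W ⟩
      (x , H ∸ Cxy)             ≡⟨ cong (λ c → x , H ∸ c) (∣x-h∣⊔[h∸y]≡h∸y H y≤x x+y≤2H) ⟩
      (x , H ∸ (H ∸ y))         ≡⟨ cong (x ,_) (m∸[m∸n]≡n y≤H) ⟩
      (x , y)                   ∎
      where
        open ≡-Reasoning
        x+y≤2H : x + y ≤ H + H
        x+y≤2H = ≤-trans (+-monoʳ-≤ x y≤u) (≤-trans (≤-reflexive x+u≡W) W≤2H)

    decode-top : x ≤ y → W ∸ x ≤ y → W < y + y → decode (x ⊔ y , (W ∸ x) ⊔ y , Cxy) ≡ (x , y)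
    decode-top x≤y u≤y W<y+y = begin
      decode (x ⊔ y , (W ∸ x) ⊔ y , Cxy)
        ≡⟨ cong₂ (λ A B → decode (A , B , Cxy)) (m≤n⇒m⊔n≡n x≤y) (m≤n⇒m⊔n≡n u≤y) ⟩
      decode (y , y , Cxy)  ≡⟨ decode-≡ W<y+y ⟩
      (H ∸ Cxy , y)         ≡⟨ cong (λ c → H ∸ c , y) (∣x-h∣⊔[h∸y]≡h∸x H x≤y y≤H) ⟩
      (H ∸ (H ∸ x) , y)     ≡⟨ cong (_, y) (m∸[m∸n]≡n (≤-trans x≤y y≤H)) ⟩
      (x , y)               ∎
      where open ≡-Reasoning

    decode-left : x < y → y < W ∸ x → decode (x ⊔ y , (W ∸ x) ⊔ y , Cxy) ≡ (x , y)
    decode-left x<y y<u = begin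
      decode (x ⊔ y , (W ∸ x) ⊔ y , Cxy)
        ≡⟨ cong₂ (λ A B → decode (A , B , Cxy)) (m≤n⇒m⊔n≡n (<⇒≤ x<y)) (m≥n⇒m⊔n≡m (<⇒≤ y<u)) ⟩
      decode (y , W ∸ x , Cxy)  ≡⟨ decode-< W<y+u y<u ⟩
      (W ∸ (W ∸ x) , y)         ≡⟨ cong (_, y) (m∸[m∸n]≡n x≤W) ⟩
      (x , y)                   ∎
      where
        open ≡-Reasoning
        W<y+u : W < y + (W ∸ x)
        W<y+u = subst (_< y + (W ∸ x)) x+u≡W (+-monoˡ-< (W ∸ x) x<y)

    decode-right : y < x → W ∸ x < y → decode (x ⊔ y , (W ∸ x) ⊔ y , Cxy) ≡ (x , y)
    decode-right y<x u<y = begin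
      decode (x ⊔ y , (W ∸ x) ⊔ y , Cxy)
        ≡⟨ cong₂ (λ A B → decode (A , B , Cxy)) (m≥n⇒m⊔n≡m (<⇒≤ y<x)) (m≤n⇒m⊔n≡n (<⇒≤ u<y)) ⟩
      decode (x , y , Cxy)  ≡⟨ decode-> W<x+y y<x ⟩
      (x , y)               ∎
      where
        open ≡-Reasoning
        W<x+y : W < x + y
        W<x+y = subst (_< x + y) x+u≡W (+-monoʳ-< x u<y)

  decode-code : W ≤ H + H → x ≤ W → y ≤ H → decode (code (x , y)) ≡ (x , y)
  decode-code {x} {y} W≤2H x≤W y≤H =
    trans (cong decode (code-box x≤W y≤H)) (by-region (<-cmp y x))
    where
      x+u≡W : x + (W ∸ x) ≡ W
      x+u≡W = m+[n∸m]≡n x≤W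
      by-region : Tri (y < x) (y ≡ x) (x < y) →
                  decode (x ⊔ y , (W ∸ x) ⊔ y , ∣ x - H ∣ ⊔ (H ∸ y)) ≡ (x , y)
      by-region (tri< y<x _ _) with y ≤? W ∸ x
      ... | yes y≤u = decode-bottom x≤W y≤H W≤2H (<⇒≤ y<x) y≤u
      ... | no  y≰u = decode-right x≤W y≤H y<x (≰⇒> y≰u)
      by-region (tri≈ _ refl _) with y ≤? W ∸ y
      ... | yes y≤u = decode-bottom x≤W y≤H W≤2H ≤-refl y≤u
      ... | no  y≰u = decode-top x≤W y≤H ≤-refl (<⇒≤ (≰⇒> y≰u))
                        (subst (_< y + y) x+u≡W (+-monoʳ-< y (≰⇒> y≰u)))
      by-region (tri> _ _ x<y) with y <? W ∸ x
      ... | yes y<u = decode-left x≤W y≤H x<y y<u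
      ... | no  y≮u = decode-top x≤W y≤H (<⇒≤ x<y) (≮⇒≥ y≮u)
                        (subst (_< y + y) x+u≡W (+-mono-<-≤ x<y (≮⇒≥ y≮u)))

odd-neighbour : 1 ≤ L → a ≤ L →
  ∃[ c ] ∃[ o ] c < L × o ≤ L × o ≢ a × Diff1 (2 * a) (suc (2 * c)) × Diff1 (2 * o) (suc (2 * c))
odd-neighbour {L} {a} 1≤L a≤L with a <? L
... | yes a<L = a , suc a , a<L , a<L , (λ ()) , inj₂ refl , inj₁ (2*-suc a)
odd-neighbour {a = suc c} _ c<L | no _ =
  c , c , c<L , ≤-trans (n≤1+n c) c<L , (λ ()) , inj₁ (2*-suc c) , inj₂ refl
odd-neighbour {a = zero} 1≤L _ | no 0≮L = contradiction 1≤L 0≮L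

module VillarceauGrid (m n' : ℕ) (1≤m : 1 ≤ m) (1≤n' : 1 ≤ n') where

  n W H : ℕ
  n = suc n'
  W = 2 * n'
  H = 2 * m

  1≤W : 1 ≤ W
  1≤W = ≤-trans 1≤n' (m≤m+n n' (n' + 0))

  1≤H : 1 ≤ H
  1≤H = ≤-trans 1≤m (m≤m+n m (m + 0))

  walk-d∞ : Box W H u → Box W H v → d∞ u v ≡ k → Walk m n u v k
  walk-d∞ {u} {v} {zero} u∈ v∈ e with refl ← d∞≡0⇒≡ {u} {v} e = here (box⇒isVertex u∈)
  walk-d∞ {x₁ , y₁} {x₂ , y₂} {suc k} u∈@(x₁≤W , y₁≤H , px₁≡py₁) v∈@(x₂≤W , y₂≤H , px₂≡py₂) e
    with step-towards 1≤W x₁≤W x₂≤W | step-towards 1≤H y₁≤H y₂≤H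
  ... | x′ , dx , x′≤W , ex | y′ , dy , y′≤H , ey =
    step (box⇒isVertex u∈ , box⇒isVertex w∈ , dx , dy) (walk-d∞ w∈ v∈ d∞w≡k)
    where
      w∈ : Box W H (x′ , y′)
      w∈ = x′≤W , y′≤H ,
        ℙ.⁻¹-injective (trans (sym (Diff1⇒parity⁻¹ dx)) (trans px₁≡py₁ (Diff1⇒parity⁻¹ dy)))
      p∣Δx∣≡p∣Δy∣ : parity ∣ x₁ - x₂ ∣ ≡ parity ∣ y₁ - y₂ ∣
      p∣Δx∣≡p∣Δy∣ = trans (parity-∣-∣ x₁ x₂)
        (trans (cong₂ ℙ._+_ px₁≡py₁ px₂≡py₂) (sym (parity-∣-∣ y₁ y₂)))
      d∞w≡k : d∞ (x′ , y′) (x₂ , y₂) ≡ k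
      d∞w≡k = trans (cong₂ _⊔_ ex ey) (approach-⊔ {∣ x₁ - x₂ ∣} {∣ y₁ - y₂ ∣} p∣Δx∣≡p∣Δy∣ e)

  dist-d∞ : IsVertex m n u → IsVertex m n v → Dist m n u v (d∞ u v)
  dist-d∞ u∈ v∈ = walk-d∞ (isVertex⇒box u∈) (isVertex⇒box v∈) refl , λ _ → walk⇒d∞≤

  dist⇒≡d∞ : IsVertex m n u → IsVertex m n v → Dist m n u v k → k ≡ d∞ u v
  dist⇒≡d∞ u∈ v∈ (walk , minimal) = ≤-antisym (minimal _ (proj₁ (dist-d∞ u∈ v∈))) (walk⇒d∞≤ walk)

  sameCode⇒d∞ : IsVertex m n s → IsVertex m n t → All (IsVertex m n) R →
                SameCode m n R s t → All (λ r → d∞ s r ≡ d∞ t r) R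
  sameCode⇒d∞ s∈ t∈ R⊆V same = All.zipWith
    (λ (r∈ , (_ , ds , dt)) → trans (sym (dist⇒≡d∞ s∈ r∈ ds)) (dist⇒≡d∞ t∈ r∈ dt))
    (R⊆V , same)

  d∞⇒sameCode : IsVertex m n s → IsVertex m n t → All (IsVertex m n) R →
                All (λ r → d∞ s r ≡ d∞ t r) R → SameCode m n R s t
  d∞⇒sameCode {s} {t} s∈ t∈ R⊆V same = All.zipWith
    (λ {r} (r∈ , e) → d∞ s r , dist-d∞ s∈ r∈ , subst (Dist m n t r) (sym e) (dist-d∞ t∈ r∈))
    (R⊆V , same)

  d∞-adjacent : Adj m n s v → IsVertex m n w → Diff1 (d∞ s w) (d∞ v w)
  d∞-adjacent s~v@(s∈ , v∈ , _) w∈ = dist-adjacent s~v (dist-d∞ s∈ w∈) (dist-d∞ v∈ w∈)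

  d∞-common-neighbour : Adj m n s v → Adj m n t v → s ≢ t → d∞ s t ≡ 2
  d∞-common-neighbour s~v t~v s≢t with d∞-adjacent s~v (proj₁ t~v) | adj⇒d∞≡1 (adj-sym t~v)
  ... | inj₁ e | v~t≡1 = trans e (cong suc v~t≡1)
  ... | inj₂ e | v~t≡1 = contradiction (d∞≡0⇒≡ (suc-injective (trans (sym e) v~t≡1))) s≢t

  record Claw (a : Point) : Set where
    field
      centre s₁ s₂ s₃ : Point
      s₁~centre : Adj m n s₁ centre
      s₂~centre : Adj m n s₂ centre
      s₃~centre : Adj m n s₃ centre
      s₁≢s₂ : s₁ ≢ s₂
      s₁≢s₃ : s₁ ≢ s₃
      s₂≢s₃ : s₂ ≢ s₃
      radius : ℕ
      d∞s₁a : d∞ s₁ a ≡ radius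
      d∞s₂a : d∞ s₂ a ≡ radius
      d∞s₃a : d∞ s₃ a ≡ radius

  claw : IsVertex m n u → Claw u
  claw u∈@(odd i j (s≤s i<n') j<m) = record
    { centre = suc (2 * i) , suc (2 * j)
    ; s₁~centre = s₁~u ; s₂~centre = s₂~u ; s₃~centre = s₃~u
    ; s₁≢s₂ = 2*-≢ {i} {suc i} (λ ()) ∘′ cong proj₁
    ; s₁≢s₃ = 2*-≢ {j} {suc j} (λ ()) ∘′ cong proj₂
    ; s₂≢s₃ = 2*-≢ {suc i} {i} (λ ()) ∘′ cong proj₁
    ; radius = 1
    ; d∞s₁a = adj⇒d∞≡1 s₁~u ; d∞s₂a = adj⇒d∞≡1 s₂~u ; d∞s₃a = adj⇒d∞≡1 s₃~u
    }
    where
      s₁~u : Adj m n (2 * i , 2 * j) (suc (2 * i) , suc (2 * j))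
      s₁~u = even i j (s≤s (<⇒≤ i<n')) (<⇒≤ j<m) , u∈ , inj₂ refl , inj₂ refl
      s₂~u : Adj m n (2 * suc i , 2 * j) (suc (2 * i) , suc (2 * j))
      s₂~u = even (suc i) j (s≤s i<n') (<⇒≤ j<m) , u∈ , inj₁ (2*-suc i) , inj₂ refl
      s₃~u : Adj m n (2 * i , 2 * suc j) (suc (2 * i) , suc (2 * j))
      s₃~u = even i (suc j) (s≤s (<⇒≤ i<n')) j<m , u∈ , inj₂ refl , inj₁ (2*-suc j)
  claw u∈@(even i j (s≤s i≤n') j≤m) with odd-neighbour 1≤n' i≤n' | odd-neighbour 1≤m j≤m
  ... | ci , oi , ci<n' , oi≤n' , oi≢i , di , doi | cj , oj , cj<m , oj≤m , oj≢j , dj , doj = record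
    { centre = cell
    ; s₁~centre = s₁~c ; s₂~centre = s₂~c ; s₃~centre = s₃~c
    ; s₁≢s₂ = 2*-≢ oi≢i ∘′ cong proj₁
    ; s₁≢s₃ = 2*-≢ (oj≢j ∘′ sym) ∘′ cong proj₂
    ; s₂≢s₃ = 2*-≢ (oi≢i ∘′ sym) ∘′ cong proj₁
    ; radius = 2
    ; d∞s₁a = d∞-common-neighbour s₁~c u~c (2*-≢ oi≢i ∘′ cong proj₁)
    ; d∞s₂a = d∞-common-neighbour s₂~c u~c (2*-≢ oj≢j ∘′ cong proj₂)
    ; d∞s₃a = d∞-common-neighbour s₃~c u~c (2*-≢ oi≢i ∘′ cong proj₁)
    }
    where
      cell : Point
      cell = suc (2 * ci) , suc (2 * cj)
      c∈ : IsVertex m n cell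
      c∈ = odd ci cj (s≤s ci<n') cj<m
      u~c : Adj m n (2 * i , 2 * j) cell
      u~c = u∈ , c∈ , di , dj
      s₁~c : Adj m n (2 * oi , 2 * j) cell
      s₁~c = even oi j (s≤s oi≤n') j≤m , c∈ , doi , dj
      s₂~c : Adj m n (2 * i , 2 * oj) cell
      s₂~c = even i oj (s≤s i≤n') oj≤m , c∈ , di , doj
      s₃~c : Adj m n (2 * oi , 2 * oj) cell
      s₃~c = even oi oj (s≤s oi≤n') oj≤m , c∈ , doi , doj

  claw⇒twins : Claw u → IsVertex m n u → IsVertex m n v → Twins m n (u ∷ v ∷ [])
  claw⇒twins {u} {v} K u∈ v∈ =
    pick (Diff1-pigeonhole (d∞-adjacent s₁~centre v∈) (d∞-adjacent s₂~centre v∈)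
                           (d∞-adjacent s₃~centre v∈))
    where
      open Claw K
      twins : Adj m n s centre → Adj m n t centre → s ≢ t →
              d∞ s u ≡ radius → d∞ t u ≡ radius → d∞ s v ≡ d∞ t v → Twins m n (u ∷ v ∷ [])
      twins (s∈ , _) (t∈ , _) s≢t su tu sv≡tv =
        _ , _ , s∈ , t∈ , s≢t , d∞⇒sameCode s∈ t∈ (u∈ ∷ v∈ ∷ []) (trans su (sym tu) ∷ sv≡tv ∷ [])
      pick : d∞ s₁ v ≡ d∞ s₂ v ⊎ d∞ s₁ v ≡ d∞ s₃ v ⊎ d∞ s₂ v ≡ d∞ s₃ v → Twins m n (u ∷ v ∷ [])
      pick (inj₁ e)        = twins s₁~centre s₂~centre s₁≢s₂ d∞s₁a d∞s₂a e
      pick (inj₂ (inj₁ e)) = twins s₁~centre s₃~centre s₁≢s₃ d∞s₁a d∞s₃a e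
      pick (inj₂ (inj₂ e)) = twins s₂~centre s₃~centre s₂≢s₃ d∞s₂a d∞s₃a e

  twins-pair : IsVertex m n u → IsVertex m n v → Twins m n (u ∷ v ∷ [])
  twins-pair u∈ v∈ = claw⇒twins (claw u∈) u∈ v∈

  resolving⇒3≤length : ∀ R → Resolving m n R → 3 ≤ length R
  resolving⇒3≤length [] resolving =
    contradiction resolving (twins⇒¬resolving (twins-tail (twins-tail (twins-pair o∈ o∈))))
    where
      o∈ : IsVertex m n (0 , 0)
      o∈ = even 0 0 (s≤s z≤n) z≤n
  resolving⇒3≤length (_ ∷ []) resolving@(_ , u∈ ∷ [] , _) =
    contradiction resolving (twins⇒¬resolving (twins-tail (twins-pair u∈ u∈)))
  resolving⇒3≤length (_ ∷ _ ∷ []) resolving@(_ , u∈ ∷ v∈ ∷ [] , _) =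
    contradiction resolving (twins⇒¬resolving (twins-pair u∈ v∈))
  resolving⇒3≤length (_ ∷ _ ∷ _ ∷ _) _ = s≤s (s≤s (s≤s z≤n))

  open Decoding W H

  landmarks : List Point
  landmarks = (0 , 0) ∷ (W , 0) ∷ (H , H) ∷ []

  landmarks-resolving : m ≤ n' → n' ≤ 2 * m → Resolving m n landmarks
  landmarks-resolving m≤n' n'≤2m = distinct , landmarks⊆V , resolves
    where
      distinct : Unique landmarks
      distinct = ((<⇒≢ 1≤W ∘′ cong proj₁) ∷ (<⇒≢ 1≤H ∘′ cong proj₁) ∷ [])
               ∷ ((<⇒≢ 1≤H ∘′ cong proj₂) ∷ []) ∷ [] ∷ []
      landmarks⊆V : All (IsVertex m n) landmarks
      landmarks⊆V = even 0 0 (s≤s z≤n) z≤n ∷ even n' 0 ≤-refl z≤n ∷ even m m (s≤s m≤n') ≤-refl ∷ []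
      W≤H+H : W ≤ H + H
      W≤H+H = ≤-trans (*-monoʳ-≤ 2 n'≤2m) (≤-reflexive (cong (H +_) (+-identityʳ H)))
      decode-code-vertex : IsVertex m n s → decode (code s) ≡ s
      decode-code-vertex s∈ with x≤W , y≤H , _ ← isVertex⇒box s∈ = decode-code W≤H+H x≤W y≤H
      resolves : ∀ s t → IsVertex m n s → IsVertex m n t → SameCode m n landmarks s t → s ≡ t
      resolves s t s∈ t∈ same with sameCode⇒d∞ s∈ t∈ landmarks⊆V same
      ... | e₁ ∷ e₂ ∷ e₃ ∷ [] = begin
        s                 ≡⟨ decode-code-vertex s∈ ⟨
        decode (code s)   ≡⟨ cong decode (cong₂ _,_ e₁ (cong₂ _,_ e₂ e₃)) ⟩
        decode (code t)   ≡⟨ decode-code-vertex t∈ ⟩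
        t                 ∎
        where open ≡-Reasoning

theorem3 : (m n : ℕ) → 1 ≤ m → m < n → n ≤ 2 * m + 1 → MetricDim m n 3
theorem3 m (suc n') 1≤m (s≤s m≤n') n≤2m+1 =
  (landmarks , landmarks-resolving m≤n' n'≤2m , refl) , resolving⇒3≤length
  where
    open VillarceauGrid m n' 1≤m (≤-trans 1≤m m≤n')
    n'≤2m : n' ≤ 2 * m
    n'≤2m = ≤-pred (subst (suc n' ≤_) (+-comm (2 * m) 1) n≤2m+1)
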